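{- Let $\epsilon\ge1$, let $g_1,\dots,g_\epsilon$ be nonnegative integers and $s_1,\dots,s_\epsilon,t_1,\dots,t_\epsilon$ integers such that $0<g_\iota$ and $t_\iota-s_\iota\le g_\iota$ for $\iota=1,\dots,\epsilon$. Then the statement "for each $\iota=1,\dots,\epsilon$ there exists an integer $z$ with $s_\iota<zg_\iota<t_\iota$" is equivalent to the statement "for every nonnegative integer $f$ with $f\le F_\epsilon(s_1,\dots,s_\epsilon,t_1,\dots,t_\epsilon)$ one has $W_\epsilon(g_1,\dots,g_\epsilon,s_1,\dots,s_\epsilon,t_1,\dots,t_\epsilon,f)>0$".
   Context: Define $Z(g,s,t,y)=((y-1)g-s)(yg-t)$. For $\iota=0,\dots,\epsilon$ let $F_\iota(s_1,\dots,s_\iota,t_1,\dots,t_\iota)=\sum_{\mu=1}^{\iota}(2s_\mu^2+2t_\mu^2+4)$ (so $F_0=0$). For $\iota=1,\dots,\epsilon$ let $Z_\iota(g_\iota,s_1,\dots,s_\iota,t_1,\dots,t_\iota,y)=Z\bigl(g_\iota,s_\iota,t_\iota,\;y-F_{\iota-1}(s_1,\dots,s_{\iota-1},t_1,\dots,t_{\iota-1})-s_\iota^2-t_\iota^2-2\bigr)$, and let $W_\epsilon(g_1,\dots,g_\epsilon,s_1,\dots,s_\epsilon,t_1,\dots,t_\epsilon,y)=\prod_{\iota=1}^{\epsilon}Z_\iota(g_\iota,s_1,\dots,s_\iota,t_1,\dots,t_\iota,y)$. -}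

module Defs where

open import Data.Nat using (ℕ; zero; suc)
open import Data.Fin using (Fin; zero; suc)
open import Data.Integer using (ℤ; _+_; _*_; _-_; +_)

Z : ℤ → ℤ → ℤ → ℤ → ℤ
Z g s t y = ((y - + 1) * g - s) * (y * g - t)

-- Sequences s_1..s_ε are functions Fin ε → ℤ (index zero = s_1).
-- F ι s t sums the first ι terms (ι : ℕ; terms beyond ε are never used
-- since we only call it with ι ≤ ε).
F : {ε : ℕ} → ℕ → (Fin ε → ℤ) → (Fin ε → ℤ) → ℤ
F zero s t = + 0
F {zero} (suc ι) s t = + 0
F {suc ε} (suc ι) s t =
  (+ 2 * (s zero * s zero) + + 2 * (t zero * t zero) + + 4)
  + F ι (λ i → s (suc i)) (λ i → t (suc i))

Fε : {ε : ℕ} → (Fin ε → ℤ) → (Fin ε → ℤ) → ℤ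
Fε {ε} = F ε

-- Z_ι(g_ι, s, t, y) = Z(g_ι, s_ι, t_ι, y - F_{ι-1} - s_ι² - t_ι² - 2)
-- for the index i : Fin ε (i = ι - 1, so F_{ι-1} = F (toℕ i)).
Zι : {ε : ℕ} → (Fin ε → ℤ) → (Fin ε → ℤ) → (Fin ε → ℤ) → ℤ → Fin ε → ℤ
Zι g s t y i =
  Z (g i) (s i) (t i)
    (y - F (Data.Fin.toℕ i) s t - s i * s i - t i * t i - + 2)

∏ : {ε : ℕ} → (Fin ε → ℤ) → ℤ
∏ {zero} f = + 1
∏ {suc ε} f = f zero * ∏ (λ i → f (suc i))

W : {ε : ℕ} → (Fin ε → ℤ) → (Fin ε → ℤ) → (Fin ε → ℤ) → ℤ → ℤ
W g s t y = ∏ (Zι g s t y)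

-- Write K(s,t) = s² + t² + 2.  The sum F_ε cuts [0, F_ε] into consecutive
-- windows [F_{ι-1}, F_ι] of width 2·K(s_ι,t_ι), and on the ι-th window the
-- factor Z_ι is Z(g_ι, s_ι, t_ι, y) with y = f − (F_{ι-1} + K(s_ι,t_ι))
-- running over [−K, K].  Three facts about the single quadratic Z drive
-- everything:
--   * Z(g,s,t,y) > 0 for |y| ≥ K (proved for y ≥ K; y ≤ −K follows from the
--     symmetry Z(g,s,t,y) = Z(g,−t,−s,1−y)), so every factor Z_j is positive
--     outside its own window;
--   * if s < zg < t with t − s ≤ g, then Z(g,s,t,y) > 0 for every y;
--   * if (z−1)g ≤ s and t ≤ zg then Z(g,s,t,z) ≤ 0, and when (z−1)g ≤ s < zg
--     this z satisfies |z| ≤ K, i.e. it lies in the window.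
-- The forward implication is the second fact factorwise.  Conversely, if
-- some window contains no multiple of g_ι, the floor z of the third fact
-- places a point f ∈ [0, F_ε] where Z_ι ≤ 0 while all other factors are
-- positive by the first fact, so W_ε(f) ≤ 0.
module Submission where

open import Defs
open import Data.Nat using (ℕ; _≥_)
open import Data.Fin using (Fin)
open import Data.Integer using (ℤ; _<_; _≤_; _*_; _-_; +_)
open import Data.Product using (∃; _×_)
open import Function.Bundles using (_⇔_)

import Data.Nat as ℕ
open import Data.Integer using (_+_; -_; -[1+_]; +[1+_]; 0ℤ; 1ℤ; +≤+; +<+; ∣_∣)
import Data.Integer.Properties as ℤP
open import Data.Integer.DivMod using (_/ℕ_; [n/ℕd]*d≤n; n<s[n/ℕd]*d)
open import Data.Integer.Tactic.RingSolver using (solve-∀)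
open import Data.Fin using (zero; suc; toℕ)
import Data.Fin.Properties as FinP
open import Data.Product using (_,_; proj₁; proj₂)
open import Data.Sum using (_⊎_; inj₁; inj₂)
open import Data.Empty using (⊥-elim)
open import Relation.Nullary using (yes; no)
open import Relation.Binary.PropositionalEquality
  using (_≡_; _≢_; sym; trans; cong; subst)
open import Relation.Binary.Definitions using (tri<; tri≈; tri>)
open import Function.Bundles using (mk⇔)

-- Signs of sums and products of integers.  Most inequalities below are
-- proved by writing a quantity, via a ring identity, as a sum of terms
-- that are manifestly nonnegative by these lemmas.

0≤+ : ∀ {n} → 0ℤ ≤ + n
0≤+ = +≤+ ℕ.z≤n

0<+suc : ∀ {n} → 0ℤ < +[1+ n ]
0<+suc = +<+ (ℕ.s≤s ℕ.z≤n)

nonneg+nonneg : ∀ {a b} → 0ℤ ≤ a → 0ℤ ≤ b → 0ℤ ≤ a + b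
nonneg+nonneg = ℤP.+-mono-≤

nonneg+pos : ∀ {a b} → 0ℤ ≤ a → 0ℤ < b → 0ℤ < a + b
nonneg+pos = ℤP.+-mono-≤-<

pos+nonneg : ∀ {a b} → 0ℤ < a → 0ℤ ≤ b → 0ℤ < a + b
pos+nonneg = ℤP.+-mono-<-≤

nonneg*nonneg : ∀ {a b} → 0ℤ ≤ a → 0ℤ ≤ b → 0ℤ ≤ a * b
nonneg*nonneg {+ m} {+ n} _ _ = subst (0ℤ ≤_) (ℤP.pos-* m n) 0≤+

pos*pos : ∀ {a b} → 0ℤ < a → 0ℤ < b → 0ℤ < a * b
pos*pos {+[1+ m ]} {+[1+ n ]} _ _ = +<+ (ℕ.s≤s ℕ.z≤n)
pos*pos {+ ℕ.zero} (+<+ ())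
pos*pos {+[1+ m ]} {+ ℕ.zero} _ (+<+ ())

neg*neg : ∀ {a b} → 0ℤ < - a → 0ℤ < - b → 0ℤ < a * b
neg*neg {a} {b} -a>0 -b>0 = subst (0ℤ <_) (negate-both a b) (pos*pos -a>0 -b>0)
  where
  negate-both : ∀ a b → (- a) * (- b) ≡ a * b
  negate-both = solve-∀

nonpos*nonneg : ∀ {a b} → a ≤ 0ℤ → 0ℤ ≤ b → a * b ≤ 0ℤ
nonpos*nonneg {a} {b} a≤0 0≤b =
  ℤP.neg-cancel-≤ (subst (0ℤ ≤_) (sym (ℤP.neg-distribˡ-* a b))
                         (nonneg*nonneg (ℤP.neg-mono-≤ a≤0) 0≤b))

≤-by-gap : ∀ {a b c d} → d - c ≡ b - a → c ≤ d → a ≤ b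
≤-by-gap gap c≤d = ℤP.0≤i-j⇒j≤i (subst (0ℤ ≤_) gap (ℤP.i≤j⇒0≤j-i c≤d))

0<-gap : ∀ {a b} → a < b → 0ℤ < b - a
0<-gap {a} {b} a<b = subst (_< b - a) (ℤP.+-inverseʳ a) (ℤP.+-monoˡ-< (- a) a<b)

0≤pred : ∀ {g} → 0ℤ < g → 0ℤ ≤ g - 1ℤ
0≤pred g>0 = ℤP.i≤j⇒0≤j-i (ℤP.i<j⇒suc[i]≤j g>0)

0≤square : ∀ s → 0ℤ ≤ s * s
0≤square (+ n) = nonneg*nonneg {+ n} {+ n} 0≤+ 0≤+
0≤square -[1+ n ] = 0≤+

-- s² − s = s(s − 1) ≥ 0 on the integers, since no integer lies in (0, 1).
0≤square-minus : ∀ s → 0ℤ ≤ s * s - s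
0≤square-minus (+ ℕ.zero) = 0≤+
0≤square-minus +[1+ n ] =
  subst (0ℤ ≤_) (factor +[1+ n ]) (nonneg*nonneg {+[1+ n ]} {+[1+ n ] - 1ℤ} 0≤+ 0≤+)
  where
  factor : ∀ s → s * (s - 1ℤ) ≡ s * s - s
  factor = solve-∀
0≤square-minus -[1+ n ] = 0≤+

0≤square-plus : ∀ s → 0ℤ ≤ s * s + s
0≤square-plus s = subst (0ℤ ≤_) (reflect s) (0≤square-minus (- s))
  where
  reflect : ∀ s → (- s) * (- s) - (- s) ≡ s * s + s
  reflect = solve-∀

≥1-or-≤0 : ∀ z → 0ℤ ≤ z - 1ℤ ⊎ 0ℤ ≤ - z
≥1-or-≤0 (+ ℕ.zero) = inj₂ 0≤+
≥1-or-≤0 +[1+ n ] = inj₁ 0≤+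
≥1-or-≤0 -[1+ n ] = inj₂ 0≤+

-- The half-width K(s,t) = s² + t² + 2 of a window, and the full width
-- 2K(s,t) = 2s² + 2t² + 4, written exactly as the summands of F.
K : ℤ → ℤ → ℤ
K s t = s * s + t * t + + 2

width : ℤ → ℤ → ℤ
width s t = + 2 * (s * s) + + 2 * (t * t) + + 4

-- Z(g,s,t,y) > 0 once y ≥ K(s,t): both factors are then positive, because
-- (y−1)g − s ≥ (y−1) − s and yg − t ≥ y − t exceed the squares.
Z-pos-above : ∀ g s t y → 0ℤ < g → K s t ≤ y → 0ℤ < Z g s t y
Z-pos-above g s t y g>0 K≤y = pos*pos lower upper
  where
  -- With h = y − K ≥ 0 we have y − 1 = h + s² + t² + 1 ≥ 0 and
  --   (y−1)g − s = (y−1)(g−1) + h + (s² − s) + t² + 1,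
  --   yg − t     = y(g−1) + h + s² + (t² − t) + 2.
  0≤h : 0ℤ ≤ y - K s t
  0≤h = ℤP.i≤j⇒0≤j-i K≤y
  0≤y-K+s²+t² : 0ℤ ≤ y - K s t + s * s + t * t
  0≤y-K+s²+t² = nonneg+nonneg (nonneg+nonneg 0≤h (0≤square s)) (0≤square t)
  lower-certificate : ∀ g s t y →
    ((y - (s * s + t * t + + 2) + s * s + t * t + + 1) * (g - 1ℤ)
      + (y - (s * s + t * t + + 2) + (s * s - s) + t * t)) + + 1
    ≡ (y - 1ℤ) * g - s
  lower-certificate = solve-∀
  upper-certificate : ∀ g s t y →
    ((y - (s * s + t * t + + 2) + s * s + t * t + + 2) * (g - 1ℤ)
      + (y - (s * s + t * t + + 2) + s * s + (t * t - t))) + + 2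
    ≡ y * g - t
  upper-certificate = solve-∀
  lower : 0ℤ < (y - 1ℤ) * g - s
  lower = subst (0ℤ <_) (lower-certificate g s t y)
    (nonneg+pos (nonneg+nonneg
        (nonneg*nonneg (nonneg+nonneg 0≤y-K+s²+t² 0≤+) (0≤pred g>0))
        (nonneg+nonneg (nonneg+nonneg 0≤h (0≤square-minus s)) (0≤square t)))
      0<+suc)
  upper : 0ℤ < y * g - t
  upper = subst (0ℤ <_) (upper-certificate g s t y)
    (nonneg+pos (nonneg+nonneg
        (nonneg*nonneg (nonneg+nonneg 0≤y-K+s²+t² 0≤+) (0≤pred g>0))
        (nonneg+nonneg (nonneg+nonneg 0≤h (0≤square s)) (0≤square-minus t)))
      0<+suc)

-- The symmetry y ↦ 1 − y, (s,t) ↦ (−t,−s) swaps and negates the two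
-- factors of Z, and preserves K.  (The ring solver needs Z unfolded.)
Z-reflect : ∀ g s t y → Z g (- t) (- s) (1ℤ - y) ≡ Z g s t y
Z-reflect = reflect
  where
  reflect : ∀ g s t y →
    (((1ℤ - y) - + 1) * g - - t) * ((1ℤ - y) * g - - s)
    ≡ ((y - + 1) * g - s) * (y * g - t)
  reflect = solve-∀

-- Z(g,s,t,y) > 0 once y ≤ −K(s,t), by reflection from Z-pos-above.
Z-pos-below : ∀ g s t y → 0ℤ < g → y ≤ - K s t → 0ℤ < Z g s t y
Z-pos-below g s t y g>0 y≤-K =
  subst (0ℤ <_) (Z-reflect g s t y)
    (Z-pos-above g (- t) (- s) (1ℤ - y) g>0
      (ℤP.≤-trans (≤-by-gap (reflected-gap s t y) y≤-K) (ℤP.i≤j+i (- y) 1ℤ)))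
  where
  reflected-gap : ∀ s t y →
    - (s * s + t * t + + 2) - y ≡ - y - ((- t) * (- t) + (- s) * (- s) + + 2)
  reflected-gap = solve-∀

-- If a multiple zg lies strictly between s and t, and t − s ≤ g, then
-- Z(g,s,t,y) > 0 for every y: for y ≤ z both factors are negative, for
-- y > z both are positive.  The two factors differ by the slack
-- g − (t − s) ≥ 0, and each is written via z − y resp. y − 1 − z.
Z-pos-window : ∀ g s t z y → 0ℤ < g → s < z * g → z * g < t → t - s ≤ g →
  0ℤ < Z g s t y
Z-pos-window g s t z y g>0 s<zg zg<t t-s≤g with y ℤP.≤? z
... | yes y≤z = neg*neg
  (subst (0ℤ <_) (lower-below g s t z y) (pos+nonneg below 0≤slack))
  (subst (0ℤ <_) (upper-below g t z y) below)
  where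
  0≤slack : 0ℤ ≤ g - (t - s)
  0≤slack = ℤP.i≤j⇒0≤j-i t-s≤g
  below : 0ℤ < (z - y) * g + (t - z * g)
  below = nonneg+pos (nonneg*nonneg (ℤP.i≤j⇒0≤j-i y≤z) (ℤP.<⇒≤ g>0))
                         (0<-gap zg<t)
  lower-below : ∀ g s t z y →
    (z - y) * g + (t - z * g) + (g - (t - s)) ≡ - ((y - 1ℤ) * g - s)
  lower-below = solve-∀
  upper-below : ∀ g t z y → (z - y) * g + (t - z * g) ≡ - (y * g - t)
  upper-below = solve-∀
... | no y≰z = pos*pos
  (subst (0ℤ <_) (lower-above g s z y) above)
  (subst (0ℤ <_) (upper-above g s t z y)
    (pos+nonneg above (ℤP.i≤j⇒0≤j-i t-s≤g)))
  where
  above : 0ℤ < (y - (1ℤ + z)) * g + (z * g - s)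
  above = nonneg+pos
    (nonneg*nonneg (ℤP.i≤j⇒0≤j-i (ℤP.i<j⇒suc[i]≤j (ℤP.≰⇒> y≰z))) (ℤP.<⇒≤ g>0))
    (0<-gap s<zg)
  lower-above : ∀ g s z y →
    (y - (1ℤ + z)) * g + (z * g - s) ≡ (y - 1ℤ) * g - s
  lower-above = solve-∀
  upper-above : ∀ g s t z y →
    (y - (1ℤ + z)) * g + (z * g - s) + (g - (t - s)) ≡ y * g - t
  upper-above = solve-∀

Z-nonpos : ∀ g s t z → (z - 1ℤ) * g ≤ s → t ≤ z * g → Z g s t z ≤ 0ℤ
Z-nonpos g s t z below above =
  nonpos*nonneg (ℤP.i≤j⇒i-j≤0 below) (ℤP.i≤j⇒0≤j-i above)

floor-multiple : ∀ s g → 0ℤ < g → ∃ λ z → (z - 1ℤ) * g ≤ s × s < z * g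
floor-multiple s (+ ℕ.zero) (+<+ ())
floor-multiple s +[1+ k ] _ =
  1ℤ + q , subst (λ x → x * +[1+ k ] ≤ s) (sym (cancel q)) ([n/ℕd]*d≤n s (ℕ.suc k))
         , n<s[n/ℕd]*d s (ℕ.suc k)
  where
  q : ℤ
  q = s /ℕ ℕ.suc k
  cancel : ∀ q → (1ℤ + q) - 1ℤ ≡ q
  cancel = solve-∀

-- The multiple z of floor-multiple satisfies |z| ≤ K(s,t); this is what
-- puts the point y = z inside the window [−K, K].
floor-bounded : ∀ g s t z → 0ℤ < g → (z - 1ℤ) * g ≤ s → s < z * g →
  - K s t ≤ z × z ≤ K s t
floor-bounded g s t z g>0 below above with ≥1-or-≤0 z
... | inj₁ z≥1 =
  ℤP.0≤i-j⇒j≤i (subst (0ℤ ≤_) (lower-pos s t z)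
    (nonneg+nonneg z≥1 (nonneg+nonneg (nonneg+nonneg (0≤square s) (0≤square t)) 0≤+))) ,
  ℤP.0≤i-j⇒j≤i (subst (0ℤ ≤_) (upper-pos g s t z)
    (nonneg+nonneg (nonneg+nonneg (nonneg+nonneg
       (nonneg+nonneg (ℤP.i≤j⇒0≤j-i below) (nonneg*nonneg z≥1 (0≤pred g>0)))
       (0≤square-minus s)) (0≤square t)) 0≤+))
  where
  lower-pos : ∀ s t z → (z - 1ℤ) + (s * s + t * t + + 3) ≡ z - - (s * s + t * t + + 2)
  lower-pos = solve-∀
  upper-pos : ∀ g s t z →
    (s - (z - 1ℤ) * g) + (z - 1ℤ) * (g - 1ℤ) + (s * s - s) + t * t + 1ℤ
    ≡ (s * s + t * t + + 2) - z
  upper-pos = solve-∀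
... | inj₂ z≤0 =
  ℤP.0≤i-j⇒j≤i (subst (0ℤ ≤_) (lower-neg g s t z)
    (nonneg+nonneg (nonneg+nonneg (nonneg+nonneg
       (nonneg+nonneg (ℤP.<⇒≤ (0<-gap above)) (nonneg*nonneg z≤0 (0≤pred g>0)))
       (0≤square-plus s)) (0≤square t)) 0≤+)) ,
  ℤP.0≤i-j⇒j≤i (subst (0ℤ ≤_) (upper-neg s t z)
    (nonneg+nonneg z≤0 (nonneg+nonneg (nonneg+nonneg (0≤square s) (0≤square t)) 0≤+)))
  where
  lower-neg : ∀ g s t z →
    (z * g - s) + (- z) * (g - 1ℤ) + (s * s + s) + t * t + + 2
    ≡ z - - (s * s + t * t + + 2)
  lower-neg = solve-∀
  upper-neg : ∀ s t z → - z + (s * s + t * t + + 2) ≡ (s * s + t * t + + 2) - z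
  upper-neg = solve-∀

F-nonneg : ∀ {ε} n (s t : Fin ε → ℤ) → 0ℤ ≤ F n s t
F-nonneg ℕ.zero s t = 0≤+
F-nonneg {ℕ.zero} (ℕ.suc n) s t = 0≤+
F-nonneg {ℕ.suc ε} (ℕ.suc n) s t =
  nonneg+nonneg
    (nonneg+nonneg (nonneg+nonneg (nonneg*nonneg {+ 2} 0≤+ (0≤square (s zero)))
                                  (nonneg*nonneg {+ 2} 0≤+ (0≤square (t zero))))
                   0≤+)
    (F-nonneg n (λ i → s (suc i)) (λ i → t (suc i)))

F-mono : ∀ {ε m n} (s t : Fin ε → ℤ) → m ℕ.≤ n → F m s t ≤ F n s t
F-mono {ε} {ℕ.zero} {n} s t _ = F-nonneg n s t
F-mono {ℕ.zero} {ℕ.suc m} {ℕ.suc n} s t _ = ℤP.≤-refl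
F-mono {ℕ.suc ε} {ℕ.suc m} {ℕ.suc n} s t (ℕ.s≤s m≤n) =
  ℤP.+-monoʳ-≤ (width (s zero) (t zero)) (F-mono (λ i → s (suc i)) (λ i → t (suc i)) m≤n)

F-step : ∀ {ε} (i : Fin ε) (s t : Fin ε → ℤ) →
  F (ℕ.suc (toℕ i)) s t ≡ F (toℕ i) s t + width (s i) (t i)
F-step zero s t = ℤP.+-comm (width (s zero) (t zero)) 0ℤ
F-step (suc i) s t =
  trans (cong (λ r → width (s zero) (t zero) + r) (F-step i (λ j → s (suc j)) (λ j → t (suc j))))
        (sym (ℤP.+-assoc (width (s zero) (t zero)) _ _))

∏-pos : ∀ {ε} (f : Fin ε → ℤ) → (∀ i → 0ℤ < f i) → 0ℤ < ∏ f
∏-pos {ℕ.zero} f _ = 0<+suc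
∏-pos {ℕ.suc ε} f pos = pos*pos (pos zero) (∏-pos (λ i → f (suc i)) (λ i → pos (suc i)))

∏-nonpos : ∀ {ε} (f : Fin ε → ℤ) (i : Fin ε) →
  (∀ j → j ≢ i → 0ℤ < f j) → f i ≤ 0ℤ → ∏ f ≤ 0ℤ
∏-nonpos {ℕ.suc ε} f zero others fi≤0 =
  nonpos*nonneg fi≤0 (ℤP.<⇒≤ (∏-pos (λ j → f (suc j)) (λ j → others (suc j) (λ ()))))
∏-nonpos {ℕ.suc ε} f (suc i) others fi≤0 =
  subst (_≤ 0ℤ) (ℤP.*-comm (∏ (λ j → f (suc j))) (f zero))
    (nonpos*nonneg
      (∏-nonpos (λ j → f (suc j)) i
         (λ j j≢i → others (suc j) (λ eq → j≢i (FinP.suc-injective eq))) fi≤0)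
      (ℤP.<⇒≤ (others zero (λ ()))))

-- Z_i evaluates Z at x − (F_i + K(s_i,t_i)), the position of x relative to
-- the centre of window i: Zι g s t x i is by definition
-- Z (g i) (s i) (t i) (centred s t x i).
centred : ∀ {ε} (s t : Fin ε → ℤ) → ℤ → Fin ε → ℤ
centred s t x i = x - F (toℕ i) s t - s i * s i - t i * t i - + 2

Zι-pos-outside : ∀ {ε} (g s t : Fin ε → ℤ) (x : ℤ) (i : Fin ε) → 0ℤ < g i →
  x ≤ F (toℕ i) s t ⊎ F (ℕ.suc (toℕ i)) s t ≤ x → 0ℤ < Zι g s t x i
Zι-pos-outside g s t x i g>0 (inj₁ x≤Fi) =
  Z-pos-below (g i) (s i) (t i) (centred s t x i) g>0
    (≤-by-gap (left-gap x (F (toℕ i) s t) (s i) (t i)) x≤Fi)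
  where
  left-gap : ∀ x Fi s t →
    Fi - x ≡ - (s * s + t * t + + 2) - (x - Fi - s * s - t * t - + 2)
  left-gap = solve-∀
Zι-pos-outside g s t x i g>0 (inj₂ Fi+1≤x) =
  Z-pos-above (g i) (s i) (t i) (centred s t x i) g>0
    (≤-by-gap (right-gap x (F (toℕ i) s t) (s i) (t i))
              (subst (_≤ x) (F-step i s t) Fi+1≤x))
  where
  right-gap : ∀ x Fi s t →
    x - (Fi + (+ 2 * (s * s) + + 2 * (t * t) + + 4))
    ≡ (x - Fi - s * s - t * t - + 2) - (s * s + t * t + + 2)
  right-gap = solve-∀

-- If x lies in the window of index ι and Z_ι(x) ≤ 0, then W(x) ≤ 0, since
-- every other window lies entirely to the left or right of x.
W-nonpos-in-window : ∀ {ε} (g s t : Fin ε → ℤ) (x : ℤ) (ι : Fin ε) →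
  (∀ i → 0ℤ < g i) → F (toℕ ι) s t ≤ x → x ≤ F (ℕ.suc (toℕ ι)) s t →
  Zι g s t x ι ≤ 0ℤ → W g s t x ≤ 0ℤ
W-nonpos-in-window g s t x ι g>0 Fι≤x x≤Fι+1 Zι≤0 =
  ∏-nonpos (Zι g s t x) ι others Zι≤0
  where
  others : ∀ j → j ≢ ι → 0ℤ < Zι g s t x j
  others j j≢ι with ℕ.<-cmp (toℕ j) (toℕ ι)
  ... | tri< j<ι _ _ =
    Zι-pos-outside g s t x j (g>0 j) (inj₂ (ℤP.≤-trans (F-mono s t j<ι) Fι≤x))
  ... | tri≈ _ j≡ι _ = ⊥-elim (j≢ι (FinP.toℕ-injective j≡ι))
  ... | tri> _ _ ι<j =
    Zι-pos-outside g s t x j (g>0 j) (inj₁ (ℤP.≤-trans x≤Fι+1 (F-mono s t ι<j)))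

-- If the least multiple z·g_ι exceeding s_ι is not below t_ι, then W is
-- nonpositive at the point f = F_ι + K(s_ι,t_ι) + z, which lies in the
-- window of index ι and hence in [0, F_ε].
W-nonpos-somewhere : ∀ {ε} (g s t : Fin ε → ℤ) (ι : Fin ε) (z : ℤ) →
  (∀ i → 0ℤ < g i) → (z - 1ℤ) * g ι ≤ s ι → s ι < z * g ι → t ι ≤ z * g ι →
  ∃ λ (f : ℕ) → + f ≤ Fε s t × W g s t (+ f) ≤ 0ℤ
W-nonpos-somewhere g s t ι z g>0 below above t≤zg =
  ∣ x ∣ , subst (_≤ Fε s t) (sym x≡f) x≤Fε , subst (λ y → W g s t y ≤ 0ℤ) (sym x≡f) Wx≤0
  where
  Fι : ℤ
  Fι = F (toℕ ι) s t
  x : ℤ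
  x = Fι + K (s ι) (t ι) + z
  z-bounds : - K (s ι) (t ι) ≤ z × z ≤ K (s ι) (t ι)
  z-bounds = floor-bounded (g ι) (s ι) (t ι) z (g>0 ι) below above
  centre-shift : ∀ Fi s t z →
    (Fi + (s * s + t * t + + 2) + z) - Fi - s * s - t * t - + 2 ≡ z
  centre-shift = solve-∀
  lower-gap : ∀ Fi s t z →
    z - - (s * s + t * t + + 2) ≡ (Fi + (s * s + t * t + + 2) + z) - Fi
  lower-gap = solve-∀
  upper-gap : ∀ Fi s t z →
    (s * s + t * t + + 2) - z
    ≡ (Fi + (+ 2 * (s * s) + + 2 * (t * t) + + 4)) - (Fi + (s * s + t * t + + 2) + z)
  upper-gap = solve-∀
  Fι≤x : Fι ≤ x
  Fι≤x = ≤-by-gap (lower-gap Fι (s ι) (t ι) z) (proj₁ z-bounds)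
  x≤Fι+1 : x ≤ F (ℕ.suc (toℕ ι)) s t
  x≤Fι+1 = subst (x ≤_) (sym (F-step ι s t))
    (≤-by-gap (upper-gap Fι (s ι) (t ι) z) (proj₂ z-bounds))
  x≤Fε : x ≤ Fε s t
  x≤Fε = ℤP.≤-trans x≤Fι+1 (F-mono s t (FinP.toℕ<n ι))
  x≡f : + ∣ x ∣ ≡ x
  x≡f = ℤP.0≤i⇒+∣i∣≡i (ℤP.≤-trans (F-nonneg (toℕ ι) s t) Fι≤x)
  Wx≤0 : W g s t x ≤ 0ℤ
  Wx≤0 = W-nonpos-in-window g s t x ι g>0 Fι≤x x≤Fι+1
    (subst (λ y → Z (g ι) (s ι) (t ι) y ≤ 0ℤ) (sym (centre-shift Fι (s ι) (t ι) z))
      (Z-nonpos (g ι) (s ι) (t ι) z below t≤zg))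

W-pos : ∀ {ε} (g s t : Fin ε → ℤ) → (∀ i → 0ℤ < g i) → (∀ i → t i - s i ≤ g i) →
  (∀ ι → ∃ λ (z : ℤ) → s ι < z * g ι × z * g ι < t ι) →
  ∀ x → 0ℤ < W g s t x
W-pos g s t g>0 gaps multiples x = ∏-pos (Zι g s t x) λ j →
  let (z , s<zg , zg<t) = multiples j in
  Z-pos-window (g j) (s j) (t j) z (centred s t x j) (g>0 j) s<zg zg<t (gaps j)

multiple-between : ∀ {ε} (g s t : Fin ε → ℤ) → (∀ i → 0ℤ < g i) →
  ((f : ℕ) → + f ≤ Fε s t → 0ℤ < W g s t (+ f)) →
  ∀ ι → ∃ λ (z : ℤ) → s ι < z * g ι × z * g ι < t ι
multiple-between g s t g>0 W>0 ι with floor-multiple (s ι) (g ι) (g>0 ι)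
... | z , below , above with z * g ι ℤP.<? t ι
...   | yes zg<t = z , above , zg<t
...   | no zg≮t with W-nonpos-somewhere g s t ι z g>0 below above (ℤP.≮⇒≥ zg≮t)
...     | f , f≤Fε , Wf≤0 = ⊥-elim (ℤP.<⇒≱ (W>0 f f≤Fε) Wf≤0)

lemma4 : (ε : ℕ) → ε ≥ 1 →
    (g s t : Fin ε → ℤ) →
    (∀ ι → + 0 ≤ g ι) →
    (∀ ι → + 0 < g ι) →
    (∀ ι → t ι - s ι ≤ g ι) →
    ((∀ ι → ∃ λ (z : ℤ) → (s ι < z * g ι) × (z * g ι < t ι))
    ⇔ ((f : ℕ) → + f ≤ Fε s t → + 0 < W g s t (+ f)))
lemma4 ε _ g s t _ g>0 gaps =
  mk⇔ (λ multiples f _ → W-pos g s t g>0 gaps multiples (+ f))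
      (multiple-between g s t g>0)
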